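{- Let $n$ be even. Then $\Gamma_n$ is an $n$-dimensional vector space over $\mathbb{F}_2$ and $\{\gamma_0,\gamma_2,\dots,\gamma_{2n-2}\}$ is a basis of it.
   Context: Let $\mathbbm{1}=(1,\dots,1)\in\mathbb{F}_2^n$, let $\odot$ denote component-wise multiplication of vectors in $\mathbb{F}_2^n$, and let $S:\mathbb{F}_2^n\to\mathbb{F}_2^n$ be the cyclic left shift $S(x_1,\dots,x_n)=(x_2,\dots,x_n,x_1)$. Define $\gamma_0=\mathrm{id}$ and, for $k\geq1$, $\gamma_{2k}(x)=S^{2k}(x)\odot(\mathbbm{1}+S^{2k-1}(x))\odot(\mathbbm{1}+S^{2k-3}(x))\odot\cdots\odot(\mathbbm{1}+S(x))$. Let $\Gamma_n$ be the $\mathbb{F}_2$-linear span of all $\gamma_{2k}:\mathbb{F}_2^n\to\mathbb{F}_2^n$, $k\geq0$, inside the vector space of all functions $\mathbb{F}_2^n\to\mathbb{F}_2^n$ (with pointwise addition). -}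

module Defs where

open import Data.Bool using (Bool; true; false; _∧_; _xor_; not; if_then_else_)
open import Data.Nat using (ℕ; zero; suc; _+_; _*_)
open import Data.Nat.DivMod using (_mod_)
open import Data.Fin using (Fin; toℕ)
open import Data.Product using (Σ; ∃)
open import Relation.Binary.PropositionalEquality using (_≡_)

-- 𝔽₂ is modelled by Bool: addition = xor, multiplication = ∧.
-- 𝔽₂ⁿ is modelled by functions Fin n → Bool (coordinates indexed 0..n-1).
Vecⁿ : ℕ → Set
Vecⁿ n = Fin n → Bool

Fn : ℕ → Set
Fn n = Vecⁿ n → Vecⁿ n

cycSuc : ∀ {n} → Fin n → Fin n
cycSuc {suc n} i = suc (toℕ i) mod suc n

S : ∀ {n} → Vecⁿ n → Vecⁿ n
S x i = x (cycSuc i)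

S^ : ∀ {n} → ℕ → Vecⁿ n → Vecⁿ n
S^ zero x = x
S^ (suc m) x = S (S^ m x)

𝟙 : ∀ {n} → Vecⁿ n
𝟙 _ = true

_⊙_ : ∀ {n} → Vecⁿ n → Vecⁿ n → Vecⁿ n
(x ⊙ y) i = x i ∧ y i

_⊕_ : ∀ {n} → Vecⁿ n → Vecⁿ n → Vecⁿ n
(x ⊕ y) i = x i xor y i

oddProd : ∀ {n} → ℕ → Vecⁿ n → Vecⁿ n
oddProd zero x = 𝟙
oddProd (suc k) x = oddProd k x ⊙ (𝟙 ⊕ S^ (2 * k + 1) x)

-- γ k  is the paper's γ_{2k}:
--   γ_0 = id,
--   γ_{2k}(x) = S^{2k}(x) ⊙ (𝟙+S^{2k-1}(x)) ⊙ ⋯ ⊙ (𝟙+S(x))   (k ≥ 1)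
γ : ∀ {n} → ℕ → Fn n
γ zero x = x
γ (suc k) x = S^ (2 * suc k) x ⊙ oddProd (suc k) x

0F : ∀ {n} → Fn n
0F x i = false

_+F_ : ∀ {n} → Fn n → Fn n → Fn n
(f +F g) x = f x ⊕ g x

_·F_ : ∀ {n} → Bool → Fn n → Fn n
c ·F f = if c then f else 0F

_≈F_ : ∀ {n} → Fn n → Fn n → Set
f ≈F g = ∀ x i → f x i ≡ g x i

lin : ∀ {n} (m : ℕ) → (Fin m → Bool) → (ℕ → Fn n) → Fn n
lin zero c g = 0F
lin (suc m) c g = (c Fin.zero ·F g 0) +F lin m (λ j → c (Fin.suc j)) (λ j → g (suc j))

InΓ : (n : ℕ) → Fn n → Set
InΓ n f = Σ ℕ λ m → Σ (Fin m → Bool) λ c → f ≈F lin m c (γ {n})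

-- Being a basis indexed by Fin n, it makes Γₙ n-dimensional.
IsBasisOfΓ : (n : ℕ) → Set
IsBasisOfΓ n =
  ((c : Fin n → Bool) → lin n c (γ {n}) ≈F 0F → ∀ i → c i ≡ false)
  × ((f : Fn n) → InΓ n f → Σ (Fin n → Bool) λ c → f ≈F lin n c (γ {n}))
  where open import Data.Product using (_×_)

{-# OPTIONS --safe #-}

-- Write h = n/2 and read coordinates of x modulo n, so that (γ k x)_i = x_{i+2k} ∏_{l<k} (1 + x_{i+2l+1})
-- (γ k is the paper's γ_{2k}). From k = h on, the product runs over all odd shifts, hence γ (k + h) = γ k
-- for k ≥ h, and every γ k lies in the span of γ 0, …, γ (n-1). For independence, evaluate a vanishing
-- combination at coordinate 0: at the indicator of {2m, 2m+1} (m < h) only γ m is nonzero, which kills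
-- the coefficients below h; at the indicator of {2m} no odd coordinate is set, so only γ m and γ (m + h)
-- are nonzero, which kills the rest.
module Submission where

open import Defs
open import Data.Nat using (ℕ)
open import Data.Nat.Divisibility using (_∣_)

open import Algebra.Bundles using (CommutativeMonoid; CommutativeRing)
open import Data.Bool using (Bool; true; false; _∧_; _xor_; not)
open import Data.Bool.Properties
  using (∧-identityʳ; ∧-zeroʳ; ∧-assoc; ∧-distribʳ-xor; xor-∧-commutativeRing)
open import Data.Fin as Fin using (Fin; toℕ; fromℕ<; punchIn)
open import Data.Fin.Properties using (toℕ-injective; toℕ-fromℕ<; toℕ<n; punchInᵢ≢i)
open import Data.Nat
  using (zero; suc; _+_; _*_; _∸_; _<_; _≤_; _≤?_; _<?_; _≟_; ⌊_/2⌋; NonZero; z<s)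
open import Data.Nat.DivMod
open import Data.Nat.Divisibility using (divides; m∣m*n; n∣m⇒m%n≡0)
open import Data.Nat.Induction using (<-rec)
open import Data.Nat.Properties
open import Data.Nat.Tactic.RingSolver using (solve-∀)
open import Data.Product using (Σ; _,_; _×_)
open import Data.Sum using (inj₁; inj₂)
open import Data.Vec.Functional using (Vector; replicate; removeAt)
open import Function using (_∘_)
open import Relation.Binary.PropositionalEquality
  using (_≡_; _≢_; refl; sym; trans; cong; cong₂; subst; module ≡-Reasoning)
open import Relation.Nullary using (does; yes; no)
open import Relation.Nullary.Decidable using (dec-true; dec-false)

module _ {a ℓ} (M : CommutativeMonoid a ℓ) where
  open CommutativeMonoid M renaming (ε to 0#)
  open import Algebra.Properties.CommutativeMonoid.Sum M
  open import Relation.Binary.Reasoning.Setoid setoid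

  sum-supported : ∀ {m} (f : Vector Carrier m) k → (∀ j → j ≢ k → f j ≈ 0#) → sum f ≈ f k
  sum-supported {suc m} f k off = begin
    sum f                      ≈⟨ sum-remove f ⟩
    f k ∙ sum (removeAt f k)   ≈⟨ ∙-congˡ (sum-cong-≋ λ j → off (punchIn k j) (punchInᵢ≢i k j)) ⟩
    f k ∙ sum (replicate m 0#) ≈⟨ ∙-congˡ (sum-replicate-zero m) ⟩
    f k ∙ 0#                   ≈⟨ identityʳ (f k) ⟩
    f k                        ∎

open import Algebra.Properties.Semiring.Sum (CommutativeRing.semiring xor-∧-commutativeRing)
open ≡-Reasoning

mod≡ : ∀ {N} .{{_ : NonZero N}} {i : Fin N} a → a % N ≡ toℕ i → a mod N ≡ i
mod≡ a eq = toℕ-injective (trans (toℕ-fromℕ< _) eq)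

mod-cong : ∀ {N} .{{_ : NonZero N}} a b → a % N ≡ b % N → a mod N ≡ b mod N
mod-cong a b eq = mod≡ a (trans eq (sym (toℕ-fromℕ< _)))

[m%n+o]%n≡[m+o]%n : ∀ m o n .{{_ : NonZero n}} → (m % n + o) % n ≡ (m + o) % n
[m%n+o]%n≡[m+o]%n m o n = begin
  (m % n + o) % n         ≡⟨ %-distribˡ-+ (m % n) o n ⟩
  (m % n % n + o % n) % n ≡⟨ cong (λ r → (r + o % n) % n) (m%n%n≡m%n m n) ⟩
  (m % n + o % n) % n     ≡⟨ %-distribˡ-+ m o n ⟨
  (m + o) % n             ∎

S^-lookup : ∀ {n} t (x : Vecⁿ (suc n)) i → S^ t x i ≡ x ((toℕ i + t) mod suc n)
S^-lookup zero x i =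
  cong x (sym (mod≡ (toℕ i + 0)
    (trans (cong (_% _) (+-identityʳ (toℕ i))) (m<n⇒m%n≡m (toℕ<n i)))))
S^-lookup {n} (suc t) x i =
  trans (S^-lookup t x (cycSuc i)) (cong x (mod-cong (toℕ (cycSuc i) + t) (toℕ i + suc t) (begin
    (toℕ (cycSuc i) + t) % suc n
      ≡⟨ cong (λ r → (r + t) % suc n) (toℕ-fromℕ< (m%n<n (suc (toℕ i)) (suc n))) ⟩
    (suc (toℕ i) % suc n + t) % suc n ≡⟨ [m%n+o]%n≡[m+o]%n (suc (toℕ i)) t (suc n) ⟩
    (suc (toℕ i) + t) % suc n         ≡⟨ cong (_% suc n) (+-suc (toℕ i) t) ⟨
    (toℕ i + suc t) % suc n           ∎)))

S^-+ : ∀ {n} a b (x : Vecⁿ n) i → S^ (a + b) x i ≡ S^ a (S^ b x) i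
S^-+ zero b x i = refl
S^-+ (suc a) b x i = S^-+ a b x (cycSuc i)

S^-length : ∀ {n} (x : Vecⁿ (suc n)) i → S^ (suc n) x i ≡ x i
S^-length {n} x i = trans (S^-lookup (suc n) x i)
  (cong x (mod≡ (toℕ i + suc n) (trans ([m+n]%n≡m%n (toℕ i) (suc n)) (m<n⇒m%n≡m (toℕ<n i)))))

S^-periodic : ∀ {n} t (x : Vecⁿ (suc n)) i → S^ (suc n + t) x i ≡ S^ t x i
S^-periodic {n} t x i = trans (S^-+ (suc n) t x i) (S^-length (S^ t x) i)

γ≡S^∧oddProd : ∀ {n} k (x : Vecⁿ n) i → γ k x i ≡ S^ (2 * k) x i ∧ oddProd k x i
γ≡S^∧oddProd zero x i = sym (∧-identityʳ (x i))
γ≡S^∧oddProd (suc k) x i = refl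

oddProd-true : ∀ {n} k (x : Vecⁿ n) i →
               (∀ l → l < k → S^ (2 * l + 1) x i ≡ false) → oddProd k x i ≡ true
oddProd-true zero x i _ = refl
oddProd-true (suc k) x i zeros =
  cong₂ (λ p s → p ∧ not s) (oddProd-true k x i (λ l → zeros l ∘ m<n⇒m<1+n)) (zeros k (n<1+n k))

oddProd-false : ∀ {n k l} (x : Vecⁿ n) i → l < k →
                S^ (2 * l + 1) x i ≡ true → oddProd k x i ≡ false
oddProd-false {k = suc k} x i l<1+k one with m<1+n⇒m<n∨m≡n l<1+k
... | inj₁ l<k  = cong (_∧ not (S^ (2 * k + 1) x i)) (oddProd-false x i l<k one)
... | inj₂ refl = trans (cong (λ s → oddProd k x i ∧ not s) one) (∧-zeroʳ _)

oddProd-repeat : ∀ {n k l} (x : Vecⁿ n) i → l < k →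
                 S^ (2 * k + 1) x i ≡ S^ (2 * l + 1) x i → oddProd (suc k) x i ≡ oddProd k x i
oddProd-repeat {k = k} {l} x i l<k same rewrite same with S^ (2 * l + 1) x i in factor
... | true  = trans (∧-zeroʳ _) (sym (oddProd-false x i l<k factor))
... | false = ∧-identityʳ _

·F-eval : ∀ {n} a (f : Fn n) x i → (a ·F f) x i ≡ a ∧ f x i
·F-eval true f x i = refl
·F-eval false f x i = refl

lin-eval : ∀ {n} m c (g : ℕ → Fn n) x i → lin m c g x i ≡ ∑[ j < m ] (c j ∧ g (toℕ j) x i)
lin-eval zero c g x i = refl
lin-eval (suc m) c g x i =
  cong₂ _xor_ (·F-eval (c Fin.zero) (g 0) x i) (lin-eval m (c ∘ Fin.suc) (g ∘ suc) x i)

lin-zero : ∀ {n} m (g : ℕ → Fn n) x i → lin m (λ _ → false) g x i ≡ false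
lin-zero zero g x i = refl
lin-zero (suc m) g x i = lin-zero m (g ∘ suc) x i

lin-single-term : ∀ {n m} c (g : ℕ → Fn n) x i (k : Fin m) →
                  (∀ j → j ≢ k → c j ∧ g (toℕ j) x i ≡ false) →
                  lin m c g x i ≡ c k ∧ g (toℕ k) x i
lin-single-term {m = m} c g x i k off =
  trans (lin-eval m c g x i)
        (sum-supported (CommutativeRing.+-commutativeMonoid xor-∧-commutativeRing) _ k off)

lin-combine : ∀ {n} N a d e (b : ℕ → Fn n) x i →
              (a ∧ lin N d b x i) xor lin N e b x i ≡ lin N (λ j → (a ∧ d j) xor e j) b x i
lin-combine N a d e b x i = begin
  (a ∧ lin N d b x i) xor lin N e b x i
    ≡⟨ cong₂ _xor_ (cong (a ∧_) (lin-eval N d b x i)) (lin-eval N e b x i) ⟩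
  (a ∧ ∑[ j < N ] (d j ∧ v j)) xor ∑[ j < N ] (e j ∧ v j)
    ≡⟨ cong (_xor ∑[ j < N ] (e j ∧ v j)) (*-distribˡ-sum a (λ j → d j ∧ v j)) ⟩
  ∑[ j < N ] (a ∧ (d j ∧ v j)) xor ∑[ j < N ] (e j ∧ v j)
    ≡⟨ ∑-distrib-+ (λ j → a ∧ (d j ∧ v j)) (λ j → e j ∧ v j) ⟨
  ∑[ j < N ] ((a ∧ (d j ∧ v j)) xor (e j ∧ v j))
    ≡⟨ sum-cong-≗ (λ j → trans (cong (_xor (e j ∧ v j)) (sym (∧-assoc a (d j) (v j))))
                               (sym (∧-distribʳ-xor (v j) (a ∧ d j) (e j)))) ⟩
  ∑[ j < N ] (((a ∧ d j) xor e j) ∧ v j)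
    ≡⟨ lin-eval N _ b x i ⟨
  lin N (λ j → (a ∧ d j) xor e j) b x i ∎
  where
  v : Fin N → Bool
  v j = b (toℕ j) x i

InSpan : ∀ {n} (N : ℕ) → (ℕ → Fn n) → Fn n → Set
InSpan N b f = Σ (Fin N → Bool) λ d → f ≈F lin N d b

generator∈span : ∀ {n N} (b : ℕ → Fn n) (k : Fin N) → InSpan N b (b (toℕ k))
generator∈span {N = N} b k = δ , λ x i → sym (begin
  lin N δ b x i
    ≡⟨ lin-single-term δ b x i k (λ j j≢k → cong (_∧ _) (dec-false (j Fin.≟ k) j≢k)) ⟩
  δ k ∧ b (toℕ k) x i    ≡⟨ cong (_∧ b (toℕ k) x i) (dec-true (k Fin.≟ k) refl) ⟩
  b (toℕ k) x i          ∎)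
  where
  δ : Fin N → Bool
  δ j = does (j Fin.≟ k)

lin∈span : ∀ {n N} {b g : ℕ → Fn n} →
           (∀ k → InSpan N b (g k)) → ∀ m c → InSpan N b (lin m c g)
lin∈span {N = N} g∈ zero c = (λ _ → false) , λ x i → sym (lin-zero N _ x i)
lin∈span {N = N} {b} {g} g∈ (suc m) c with g∈ 0 | lin∈span (g∈ ∘ suc) m (c ∘ Fin.suc)
... | d , g₀≈ | e , rest≈ = (λ j → (c Fin.zero ∧ d j) xor e j) , λ x i → begin
  lin (suc m) c g x i
    ≡⟨ cong₂ _xor_ (·F-eval (c Fin.zero) (g 0) x i) refl ⟩
  (c Fin.zero ∧ g 0 x i) xor lin m (c ∘ Fin.suc) (g ∘ suc) x i
    ≡⟨ cong₂ _xor_ (cong (c Fin.zero ∧_) (g₀≈ x i)) (rest≈ x i) ⟩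
  (c Fin.zero ∧ lin N d b x i) xor lin N e b x i
    ≡⟨ lin-combine N (c Fin.zero) d e b x i ⟩
  lin N (λ j → (c Fin.zero ∧ d j) xor e j) b x i ∎

⌊2*n/2⌋≡n : ∀ n → ⌊ 2 * n /2⌋ ≡ n
⌊2*n/2⌋≡n n = trans (cong (λ m → ⌊ n + m /2⌋) (+-identityʳ n)) (sym (n≡⌊n+n/2⌋ n))

⌊2*n+1/2⌋≡n : ∀ n → ⌊ 2 * n + 1 /2⌋ ≡ n
⌊2*n+1/2⌋≡n zero = refl
⌊2*n+1/2⌋≡n (suc n) = trans (cong ⌊_/2⌋ (2+ n)) (cong suc (⌊2*n+1/2⌋≡n n))
  where
  2+ : ∀ n → 2 * suc n + 1 ≡ 2 + (2 * n + 1)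
  2+ = solve-∀

-- h = suc h′ makes n = 2h visibly a successor, so Fin n has an origin and n is a valid modulus.
module EvenLength (h′ : ℕ) where

  h n : ℕ
  h = suc h′
  n = 2 * h

  origin : Fin n
  origin = Fin.zero

  double<n : ∀ {m} → m < h → 2 * m < n
  double<n = *-monoʳ-< 2

  odd<n : ∀ {m} → m < h → 2 * m + 1 < n
  odd<n {m} m<h = subst (_≤ n) (2*suc m) (*-monoʳ-≤ 2 m<h)
    where
    2*suc : ∀ m → 2 * suc m ≡ suc (2 * m + 1)
    2*suc = solve-∀

  double-mod-upper : ∀ {k} → h ≤ k → k < n → (2 * k) % n ≡ 2 * (k ∸ h)
  double-mod-upper {k} h≤k k<n = begin
    (2 * k) % n           ≡⟨ cong (λ j → (2 * j) % n) (m∸n+n≡m h≤k) ⟨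
    (2 * (k ∸ h + h)) % n ≡⟨ cong (_% n) (*-distribˡ-+ 2 (k ∸ h) h) ⟩
    (2 * (k ∸ h) + n) % n ≡⟨ [m+n]%n≡m%n (2 * (k ∸ h)) n ⟩
    (2 * (k ∸ h)) % n     ≡⟨ m<n⇒m%n≡m (double<n k∸h<h) ⟩
    2 * (k ∸ h)           ∎
    where
    k∸h<h : k ∸ h < h
    k∸h<h = subst (k ∸ h <_) (+-identityʳ h) (m<n+o⇒m∸n<o k h k<n)

  double-mod-injective : ∀ {j k} → h ≤ j → h ≤ k → j < n → k < n →
                         (2 * j) % n ≡ (2 * k) % n → j ≡ k
  double-mod-injective h≤j h≤k j<n k<n eq = ∸-cancelʳ-≡ h≤j h≤k (*-cancelˡ-≡ _ _ 2
    (trans (sym (double-mod-upper h≤j j<n)) (trans eq (double-mod-upper h≤k k<n))))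

  -- Reducing modulo the even number n preserves parity.
  odd≢even-mod : ∀ l k → (2 * l + 1) % n ≢ (2 * k) % n
  odd≢even-mod l k eq with () ← begin
    1                     ≡⟨ %-remove-+ˡ 1 (m∣m*n l) ⟨
    (2 * l + 1) % 2       ≡⟨ m∣n⇒o%n%m≡o%m 2 n (2 * l + 1) (m∣m*n h) ⟨
    (2 * l + 1) % n % 2   ≡⟨ cong (_% 2) eq ⟩
    (2 * k) % n % 2       ≡⟨ m∣n⇒o%n%m≡o%m 2 n (2 * k) (m∣m*n h) ⟩
    (2 * k) % 2           ≡⟨ n∣m⇒m%n≡0 (2 * k) 2 (m∣m*n k) ⟩
    0                     ∎

  -- All odd shifts 1, 3, …, 2h-1 occur by stage h, so later factors repeat earlier ones.
  oddProd-saturates : ∀ d (x : Vecⁿ n) i → oddProd (h + d) x i ≡ oddProd h x i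
  oddProd-saturates zero x i = cong (λ k → oddProd k x i) (+-identityʳ h)
  oddProd-saturates (suc d) x i = begin
    oddProd (h + suc d) x i   ≡⟨ cong (λ k → oddProd k x i) (+-suc h d) ⟩
    oddProd (suc (h + d)) x i ≡⟨ oddProd-repeat {k = h + d} x i (m<n+m d {h} z<s) shift-repeats ⟩
    oddProd (h + d) x i       ≡⟨ oddProd-saturates d x i ⟩
    oddProd h x i             ∎
    where
    odd-shift : 2 * (h + d) + 1 ≡ n + (2 * d + 1)
    odd-shift = trans (cong (_+ 1) (*-distribˡ-+ 2 h d)) (+-assoc (2 * h) (2 * d) 1)
    shift-repeats : S^ (2 * (h + d) + 1) x i ≡ S^ (2 * d + 1) x i
    shift-repeats = trans (cong (λ t → S^ t x i) odd-shift) (S^-periodic (2 * d + 1) x i)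

  γ-periodic : ∀ e (x : Vecⁿ n) i → γ (h + (h + e)) x i ≡ γ (h + e) x i
  γ-periodic e x i = begin
    γ (h + (h + e)) x i                                    ≡⟨ γ≡S^∧oddProd (h + (h + e)) x i ⟩
    S^ (2 * (h + (h + e))) x i ∧ oddProd (h + (h + e)) x i
      ≡⟨ cong₂ _∧_ shift (trans (oddProd-saturates (h + e) x i) (sym (oddProd-saturates e x i))) ⟩
    S^ (2 * (h + e)) x i ∧ oddProd (h + e) x i             ≡⟨ γ≡S^∧oddProd (h + e) x i ⟨
    γ (h + e) x i                                          ∎
    where
    shift : S^ (2 * (h + (h + e))) x i ≡ S^ (2 * (h + e)) x i
    shift = trans (cong (λ t → S^ t x i) (*-distribˡ-+ 2 h (h + e))) (S^-periodic (2 * (h + e)) x i)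

  γ-descends : ∀ {k} → n ≤ k → Σ ℕ λ j → j < k × γ {n} k ≈F γ j
  γ-descends {k} n≤k = h + e , subst (h + e <_) k≡ (m<n+m (h + e) z<s) ,
    λ x i → subst (λ j → γ j x i ≡ γ (h + e) x i) k≡ (γ-periodic e x i)
    where
    e = k ∸ n
    k≡ : h + (h + e) ≡ k
    k≡ = trans (sym (+-assoc h h e))
               (trans (cong (λ m → h + m + e) (sym (+-identityʳ h))) (m+[n∸m]≡n n≤k))

  Spanned : Fn n → Set
  Spanned = InSpan n γ

  γ∈span : ∀ k → Spanned (γ k)
  γ∈span = <-rec (Spanned ∘ γ) step
    where
    step : ∀ k → (∀ {j} → j < k → Spanned (γ j)) → Spanned (γ k)
    step k rec with k <? n
    ... | yes k<n = subst (Spanned ∘ γ) (toℕ-fromℕ< k<n) (generator∈span γ (fromℕ< k<n))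
    ... | no k≮n with γ-descends (≮⇒≥ k≮n)
    ...   | j , j<k , γₖ≈γⱼ =
      let d , γⱼ≈ = rec j<k in d , λ x i → trans (γₖ≈γⱼ x i) (γⱼ≈ x i)

  InΓ⇒spanned : ∀ f → InΓ n f → Spanned f
  InΓ⇒spanned f (m , c , f≈) =
    let e , lin≈ = lin∈span {b = γ} {g = γ} γ∈span m c in e , λ x i → trans (f≈ x i) (lin≈ x i)

  pt : (ℕ → Bool) → Vecⁿ n
  pt P i = P (toℕ i)

  S^-pt : ∀ P t → S^ t (pt P) origin ≡ P (t % n)
  S^-pt P t = trans (S^-lookup t (pt P) origin) (cong P (toℕ-fromℕ< _))

  S^-pt-< : ∀ P {t} → t < n → S^ t (pt P) origin ≡ P t
  S^-pt-< P {t} t<n = trans (S^-pt P t) (cong P (m<n⇒m%n≡m t<n))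

  -- pair m is the indicator of {2m, 2m+1}, single k that of {2k mod n}.
  pair : ℕ → ℕ → Bool
  pair m a = does (⌊ a /2⌋ ≟ m)

  single : ℕ → ℕ → Bool
  single k a = does (a ≟ (2 * k) % n)

  pair-even : ∀ m j → pair m (2 * j) ≡ does (j ≟ m)
  pair-even m j = cong (λ a → does (a ≟ m)) (⌊2*n/2⌋≡n j)

  pair-odd : ∀ m l → pair m (2 * l + 1) ≡ does (l ≟ m)
  pair-odd m l = cong (λ a → does (a ≟ m)) (⌊2*n+1/2⌋≡n l)

  γ-at-pair : ∀ {m} → m < h → ∀ j → γ j (pt (pair m)) origin ≡ does (j ≟ m)
  γ-at-pair {m} m<h j with j ≤? m
  ... | yes j≤m = begin
    γ j x origin                                 ≡⟨ γ≡S^∧oddProd j x origin ⟩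
    S^ (2 * j) x origin ∧ oddProd j x origin
      ≡⟨ cong₂ _∧_ (S^-pt-< (pair m) (double<n (≤-<-trans j≤m m<h)))
                   (oddProd-true j x origin below) ⟩
    pair m (2 * j) ∧ true                        ≡⟨ ∧-identityʳ _ ⟩
    pair m (2 * j)                               ≡⟨ pair-even m j ⟩
    does (j ≟ m)                                 ∎
    where
    x = pt (pair m)
    below : ∀ l → l < j → S^ (2 * l + 1) x origin ≡ false
    below l l<j = trans (S^-pt-< (pair m) (odd<n (<-trans (<-≤-trans l<j j≤m) m<h)))
                        (trans (pair-odd m l) (dec-false (l ≟ m) (<⇒≢ (<-≤-trans l<j j≤m))))
  ... | no j≰m = begin
    γ j x origin                                 ≡⟨ γ≡S^∧oddProd j x origin ⟩
    S^ (2 * j) x origin ∧ oddProd j x origin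
      ≡⟨ cong (S^ (2 * j) x origin ∧_) (oddProd-false x origin (≰⇒> j≰m) hit) ⟩
    S^ (2 * j) x origin ∧ false                  ≡⟨ ∧-zeroʳ _ ⟩
    false                                        ≡⟨ dec-false (j ≟ m) (>⇒≢ (≰⇒> j≰m)) ⟨
    does (j ≟ m)                                 ∎
    where
    x = pt (pair m)
    hit : S^ (2 * m + 1) x origin ≡ true
    hit = trans (S^-pt-< (pair m) (odd<n m<h)) (trans (pair-odd m m) (dec-true (m ≟ m) refl))

  γ-at-single : ∀ k j → γ j (pt (single k)) origin ≡ does ((2 * j) % n ≟ (2 * k) % n)
  γ-at-single k j = begin
    γ j x origin                               ≡⟨ γ≡S^∧oddProd j x origin ⟩
    S^ (2 * j) x origin ∧ oddProd j x origin
      ≡⟨ cong₂ _∧_ (S^-pt (single k) (2 * j)) (oddProd-true j x origin none) ⟩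
    single k ((2 * j) % n) ∧ true              ≡⟨ ∧-identityʳ _ ⟩
    does ((2 * j) % n ≟ (2 * k) % n)           ∎
    where
    x = pt (single k)
    none : ∀ l → l < j → S^ (2 * l + 1) x origin ≡ false
    none l _ = trans (S^-pt (single k) (2 * l + 1)) (dec-false (_ ≟ _) (odd≢even-mod l k))

  module _ (c : Fin n → Bool) (c⊥ : lin n c (γ {n}) ≈F 0F) where

    coefficient-vanishes : ∀ x k → γ (toℕ k) x origin ≡ true →
                           (∀ j → j ≢ k → c j ∧ γ (toℕ j) x origin ≡ false) → c k ≡ false
    coefficient-vanishes x k γₖ≡1 off = begin
      c k                          ≡⟨ ∧-identityʳ (c k) ⟨
      c k ∧ true                   ≡⟨ cong (c k ∧_) γₖ≡1 ⟨
      c k ∧ γ (toℕ k) x origin     ≡⟨ lin-single-term c γ x origin k off ⟨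
      lin n c γ x origin           ≡⟨ c⊥ x origin ⟩
      false                        ∎

    lower-vanishes : ∀ k → toℕ k < h → c k ≡ false
    lower-vanishes k k<h =
      coefficient-vanishes x k (trans (γ-at-pair k<h (toℕ k)) (dec-true (toℕ k ≟ toℕ k) refl)) off
      where
      x = pt (pair (toℕ k))
      off : ∀ j → j ≢ k → c j ∧ γ (toℕ j) x origin ≡ false
      off j j≢k = begin
        c j ∧ γ (toℕ j) x origin   ≡⟨ cong (c j ∧_) (γ-at-pair k<h (toℕ j)) ⟩
        c j ∧ does (toℕ j ≟ toℕ k) ≡⟨ cong (c j ∧_) (dec-false (toℕ j ≟ toℕ k) (j≢k ∘ toℕ-injective)) ⟩
        c j ∧ false                ≡⟨ ∧-zeroʳ (c j) ⟩
        false                      ∎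

    -- For k ≥ h the point singles out k among the upper half; the lower half is already known to vanish.
    upper-vanishes : ∀ k → h ≤ toℕ k → c k ≡ false
    upper-vanishes k h≤k =
      coefficient-vanishes x k
        (trans (γ-at-single (toℕ k) (toℕ k)) (dec-true (_ ≟ (2 * toℕ k) % n) refl)) off
      where
      x = pt (single (toℕ k))
      off : ∀ j → j ≢ k → c j ∧ γ (toℕ j) x origin ≡ false
      off j j≢k with toℕ j <? h
      ... | yes j<h = cong (_∧ γ (toℕ j) x origin) (lower-vanishes j j<h)
      ... | no j≮h = begin
        c j ∧ γ (toℕ j) x origin                       ≡⟨ cong (c j ∧_) (γ-at-single (toℕ k) (toℕ j)) ⟩
        c j ∧ does ((2 * toℕ j) % n ≟ (2 * toℕ k) % n) ≡⟨ cong (c j ∧_) (dec-false (_ ≟ _) 2j≢2k) ⟩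
        c j ∧ false                                    ≡⟨ ∧-zeroʳ (c j) ⟩
        false                                          ∎
        where
        2j≢2k : (2 * toℕ j) % n ≢ (2 * toℕ k) % n
        2j≢2k = j≢k ∘ toℕ-injective ∘ double-mod-injective (≮⇒≥ j≮h) h≤k (toℕ<n j) (toℕ<n k)

    γ-independent : ∀ k → c k ≡ false
    γ-independent k with toℕ k <? h
    ... | yes k<h = lower-vanishes k k<h
    ... | no k≮h = upper-vanishes k (≮⇒≥ k≮h)

  isBasis : IsBasisOfΓ n
  isBasis = γ-independent , InΓ⇒spanned

isBasisOfΓ-0 : IsBasisOfΓ 0
isBasisOfΓ-0 = (λ c _ ()) , λ f _ → (λ ()) , λ x ()

lemma6 : (n : ℕ) → 2 ∣ n → IsBasisOfΓ n
lemma6 _ (divides zero refl) = isBasisOfΓ-0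
lemma6 _ (divides (suc h′) refl) = subst IsBasisOfΓ (*-comm 2 (suc h′)) (EvenLength.isBasis h′)
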